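{- Let $t$ be a fixed positive integer. For every real number $\epsilon>0$ there exist infinitely many positive integers $r$ such that \[ \eta_t(r)\le(1+\epsilon)\,r^{ -1/t}. \]
   Context: A hypergraph $H=(V,E)$ has a finite vertex set and a finite multiset of edges (subsets of $V$). $H$ is $r$-uniform if each edge has $r$ vertices; it is $1$-near-regular if it is regular (all vertices have the same degree) with positive degree. An edge set is $t$-shallow if every vertex lies in at most $t$ of its edges; $\nu_t(H)$ is the maximum size of a $t$-shallow edge set. For an $r$-uniform $H$ with $N$ vertices, $\eta_t(H)=\nu_t(H)/(Nt/r)$. $\eta_t(r)$ is the infimum of $\eta_t(H)$ over all $r$-uniform regular hypergraphs $H$ with positive degree and maximum degree at least $t$.
   Formalization: The parameter ε ranges over the positive rationals rather than over all positive real numbers. -}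

module Defs where

open import Data.Nat as ℕ using (ℕ; zero; suc; _≤_; _≤?_; _⊔_)
open import Data.Fin using (Fin)
open import Data.Fin.Subset using (Subset; ∣_∣)
open import Data.Fin.Subset.Properties using (_∈?_)
open import Data.List using (List; []; _∷_; length; filter; map; foldr; allFin)
open import Data.List.Relation.Unary.All using (All; all?)
open import Data.Integer using (+_)
open import Data.Rational using (ℚ; 0ℚ; 1ℚ; _/_; _*_)
open import Data.Product using (Σ; _×_; ∃)

-- A hypergraph on vertex set Fin N with a finite multiset (list) of edges.
record Hypergraph : Set where
  field
    N     : ℕ
    edges : List (Subset N)
open Hypergraph public

degIn : {n : ℕ} → List (Subset n) → Fin n → ℕ
degIn S v = length (filter (v ∈?_) S)

deg : (H : Hypergraph) → Fin (N H) → ℕ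
deg H v = degIn (edges H) v

Uniform : ℕ → Hypergraph → Set
Uniform r H = All (λ e → ∣ e ∣ ≡ℕ r) (edges H)
  where open import Relation.Binary.PropositionalEquality renaming (_≡_ to _≡ℕ_)

RegularPos : Hypergraph → Set
RegularPos H = Σ ℕ λ d → (1 ≤ d) × ((v : Fin (N H)) → deg H v ≡ d)
  where open import Relation.Binary.PropositionalEquality

MaxDegGe : ℕ → Hypergraph → Set
MaxDegGe t H = ∃ λ (v : Fin (N H)) → t ≤ deg H v

sublists : {A : Set} → List A → List (List A)
sublists [] = [] ∷ []
sublists (x ∷ xs) = map (x ∷_) (sublists xs) Data.List.++ sublists xs
  where import Data.List

Shallow : {n : ℕ} → ℕ → List (Subset n) → Set
Shallow {n} t S = All (λ v → degIn S v ≤ t) (allFin n)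

shallow? : {n : ℕ} (t : ℕ) (S : List (Subset n)) → _
shallow? {n} t S = all? (λ v → degIn S v ≤? t) (allFin n)

nu : ℕ → Hypergraph → ℕ
nu t H = foldr _⊔_ 0 (map length (filter (shallow? t) (sublists (edges H))))

-- a / b as a rational (b = 0 gives 0; never used in that case)
divℕ : ℕ → ℕ → ℚ
divℕ a zero = 0ℚ
divℕ a (suc b) = + a / suc b

-- η_t(H) = ν_t(H) / (N t / r) for an r-uniform H
eta : ℕ → ℕ → Hypergraph → ℚ
eta t r H = divℕ (nu t H ℕ.* r) (N H ℕ.* t)

_^ℚ_ : ℚ → ℕ → ℚ
q ^ℚ zero = 1ℚ
q ^ℚ suc k = q * (q ^ℚ k)

ℕtoℚ : ℕ → ℚ
ℕtoℚ n = + n / 1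

-- Admissible hypergraphs in the infimum defining η_t(r)
Admissible : ℕ → ℕ → Hypergraph → Set
Admissible t r H = Uniform r H × RegularPos H × MaxDegGe t H

-- "η_t(r) ≤ a · r^(-1/t)" for rational a > 0, where η_t(r) is the infimum of
-- η_t(H) over admissible H.  inf ≤ c  ⇔  ∀ c' > c, ∃ H, η_t(H) < c'; every
-- c' > a·r^(-1/t) is a'·r^(-1/t) with a' > a, and (all quantities ≥ 0)
-- η < a'·r^(-1/t)  ⇔  r · η^t < a'^t.
EtaLeRoot : ℕ → ℕ → ℚ → Set
EtaLeRoot t r a = (a' : ℚ) → a Data.Rational.< a' →
  ∃ λ H → Admissible t r H × (ℕtoℚ r * (eta t r H ^ℚ t) Data.Rational.< a' ^ℚ t)
  where import Data.Rational

-- Fix a prime p and let H be the hypergraph of points and hyperplanes of the projective space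
-- PG(t + 1, p). Every hyperplane has r = 1 + p + ⋯ + pᵗ points and every point lies on r
-- hyperplanes, so H is r-uniform and r-regular with N = 1 + p r vertices. Any t + 1
-- hyperplanes share a point (t + 1 homogeneous linear equations in t + 2 unknowns have a
-- nonzero solution modulo p), so a t-shallow edge set has at most t edges and
-- η_t(H) ≤ t r / (N t) < 1 / p. Hence r η_t(H)ᵗ < r / pᵗ < p / (p − 1) ≤ 1 + ε ≤ (1 + ε)ᵗ once
-- p exceeds the denominator of ε, and r ≥ p is as large as we like since primes are unbounded.

module Submission where

open import Defs
open import Level using (Level)
open import Function using (_∘_)
open import Data.Bool using (true; false)
open import Data.Product using (∃; _×_; _,_)
open import Data.Sum using (_⊎_; inj₁; inj₂; [_,_]′)
open import Relation.Unary using (Pred; Decidable; _≐_)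
open import Relation.Nullary
open import Relation.Nullary.Decidable using (dec-true)
open import Relation.Binary using (tri<; tri≈; tri>)
open import Relation.Binary.PropositionalEquality hiding ([_])

open import Data.Nat
open import Data.Nat.Properties
open import Data.Nat.DivMod using (_%_; m%n%n≡m%n; %-distribˡ-+; %-distribˡ-*; %-remove-+ʳ; m*n%n≡0; m%n<n)
open import Data.Nat.Divisibility
  using (_∣_; _∤_; _∣?_; _∣0; ∣-trans; ∣1⇒≡1; ∣⇒≤; m%n≡0⇒n∣m; n∣m⇒m%n≡0; m∣m*n; n∣m*n;
         ∣m⇒∣m*n; ∣n⇒∣m*n; ∣m+n∣m⇒∣n; ∣m∣n⇒∣m+n; m≤n⇒m!∣n!)
open import Data.Nat.Coprimality using (Coprime; coprime-Bézout; coprime-divisor)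
import Data.Nat.Coprimality as Coprimality
open import Data.Nat.GCD using (module Bézout)
open import Data.Nat.Primality using (Prime; prime⇒nonZero; prime⇒nonTrivial; prime⇒irreducible; euclidsLemma)
open import Data.Nat.Primality.Factorisation using (factorise)
open import Data.Nat.ListAction using (product)
open import Data.Nat.Tactic.RingSolver using (solve-∀)
open import Data.Integer as ℤ using (+[1+_]; -[1+_]; +≤+; +<+)
import Data.Integer.Properties as ℤ
open import Data.Rational as ℚ using (ℚ; mkℚ; 0ℚ; 1ℚ; ↧ₙ_; toℚᵘ; nonNegative)
import Data.Rational.Properties as ℚ
open import Data.Rational.Unnormalised as ℚᵘ using (mkℚᵘ; *≤*; *<*; *≡*)
import Data.Rational.Unnormalised.Properties as ℚᵘ

open import Data.Fin using (Fin; fromℕ<)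
open import Data.Fin.Subset using (Subset; ∣_∣) renaming (_∈_ to _∈ₛ_)
open import Data.Fin.Subset.Properties using (_∈?_)
open import Data.List using (List; []; _∷_; _++_; [_]; length; map; filter; lookup; take; drop; upTo; cartesianProductWith)
open import Data.List.Properties
  using (length-map; length-++; length-++-sucʳ; length-upTo; length-take; take++drop≡id; foldr-preservesᵇ;
         filter-++; filter-all; filter-none; filter-≐)
open import Data.List.Membership.Propositional using (_∈_; find)
open import Data.List.Membership.Propositional.Properties
  using (∈-∃++; ∈-upTo⁺; ∈-upTo⁻; ∈-map⁺; ∈-++⁺ˡ; ∈-++⁺ʳ; ∈-cartesianProductWith⁺; ∈-lookup; ∈-allFin)
open import Data.List.Relation.Unary.All as All using (All; []; _∷_; all?)
import Data.List.Relation.Unary.All.Properties as All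
import Data.List.Relation.Unary.Any as ListAny
open import Data.List.Relation.Unary.Any.Properties using (lookup-index)
open import Data.List.Relation.Unary.Unique.Propositional using (Unique; []; _∷_)
open import Data.List.Relation.Unary.Unique.Propositional.Properties using (upTo⁺)
open import Data.Vec as Vec using (Vec; []; _∷_; tabulate)
open import Data.Vec.Properties using (lookup⇒[]=; []=⇒lookup; lookup∘tabulate)
open import Data.Vec.Relation.Unary.All using () renaming (All to AllV; [] to []ᵥ; _∷_ to _∷ᵥ_)
open import Data.Vec.Relation.Unary.Any as VAny using (here; there) renaming (Any to AnyV)
import Data.Vec.Relation.Unary.Any.Properties as VAny

private
  variable
    a b c ℓ ℓ′ : Level
    A : Set a
    B : Set b
    C : Set c
    n : ℕ

module _ {P : Pred A ℓ} (P? : Decidable P) where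

  count : List A → ℕ
  count xs = length (filter P? xs)

  count-++ : ∀ xs ys → count (xs ++ ys) ≡ count xs + count ys
  count-++ xs ys = trans (cong length (filter-++ P? xs ys)) (length-++ (filter P? xs))

  count-all : ∀ {xs} → All P xs → count xs ≡ length xs
  count-all pxs = cong length (filter-all P? pxs)

  count-none : ∀ {xs} → All (¬_ ∘ P) xs → count xs ≡ 0
  count-none ¬pxs = cong length (filter-none P? ¬pxs)

  count-unique : ∀ {xs y} → Unique xs → y ∈ xs → P y →
                 (∀ {z} → z ∈ xs → P z → z ≡ y) → count xs ≡ 1
  count-unique {x ∷ xs} (x∉xs ∷ xs-unique) y∈ Py only with P? x
  ... | yes Px = cong suc (count-none (All.tabulate λ z∈xs Pz →
                   All.lookup x∉xs z∈xs (trans (only (ListAny.here refl) Px) (sym (only (ListAny.there z∈xs) Pz)))))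
  ... | no ¬Px with y∈
  ...   | ListAny.here refl = contradiction Py ¬Px
  ...   | ListAny.there y∈xs = count-unique xs-unique y∈xs Py (only ∘ ListAny.there)

count-≐ : {P : Pred A ℓ} {Q : Pred A ℓ′} (P? : Decidable P) (Q? : Decidable Q) →
          P ≐ Q → ∀ xs → count P? xs ≡ count Q? xs
count-≐ P? Q? P≐Q xs = cong length (filter-≐ P? Q? P≐Q xs)

count-map : {P : Pred B ℓ} (P? : Decidable P) (f : A → B) →
            ∀ xs → count P? (map f xs) ≡ count (P? ∘ f) xs
count-map P? f [] = refl
count-map P? f (x ∷ xs) with does (P? (f x))
... | true = cong suc (count-map P? f xs)
... | false = count-map P? f xs

count-cartesianProductWith : {P : Pred C ℓ} (P? : Decidable P) {Q : Pred A ℓ′} (Q? : Decidable Q)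
  (f : A → B → C) {ys : List B} {k : ℕ} →
  (∀ {x} → Q x → count P? (map (f x) ys) ≡ k) → (∀ {x} → ¬ Q x → count P? (map (f x) ys) ≡ 0) →
  ∀ xs → count P? (cartesianProductWith f xs ys) ≡ count Q? xs * k
count-cartesianProductWith P? Q? f Q⇒k ¬Q⇒0 [] = refl
count-cartesianProductWith P? Q? f {ys} Q⇒k ¬Q⇒0 (x ∷ xs) with Q? x
... | yes Qx = trans (count-++ P? (map (f x) ys) _)
                     (cong₂ _+_ (Q⇒k Qx) (count-cartesianProductWith P? Q? f Q⇒k ¬Q⇒0 xs))
... | no ¬Qx = trans (count-++ P? (map (f x) ys) _)
                     (cong₂ _+_ (¬Q⇒0 ¬Qx) (count-cartesianProductWith P? Q? f Q⇒k ¬Q⇒0 xs))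

count-cartesianProductWith-const : {P : Pred C ℓ} (P? : Decidable P) (f : A → B → C) {ys : List B} {k : ℕ} →
  (∀ x → count P? (map (f x) ys) ≡ k) → ∀ xs → count P? (cartesianProductWith f xs ys) ≡ length xs * k
count-cartesianProductWith-const P? f slice [] = refl
count-cartesianProductWith-const P? f {ys} slice (x ∷ xs) = trans (count-++ P? (map (f x) ys) _)
  (cong₂ _+_ (slice x) (count-cartesianProductWith-const P? f slice xs))

length-cartesianProductWith : (f : A → B → C) (xs : List A) (ys : List B) →
  length (cartesianProductWith f xs ys) ≡ length xs * length ys
length-cartesianProductWith f [] ys = refl
length-cartesianProductWith f (x ∷ xs) ys = trans (length-++ (map (f x) ys))
  (cong₂ _+_ (length-map (f x) ys) (length-cartesianProductWith f xs ys))

All-image⇒map : {f : A → B} {ys : List B} → All (λ y → ∃ λ x → y ≡ f x) ys → ∃ λ xs → ys ≡ map f xs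
All-image⇒map [] = [] , refl
All-image⇒map ((x , refl) ∷ images) with All-image⇒map images
... | xs , refl = x ∷ xs , refl

module _ {n} {P : Pred (Fin n) ℓ} (P? : Decidable P) where

  subsetOf : Subset n
  subsetOf = tabulate (does ∘ P?)

  ∈-subsetOf⁺ : ∀ {i} → P i → i ∈ₛ subsetOf
  ∈-subsetOf⁺ {i} Pi = lookup⇒[]= i subsetOf (trans (lookup∘tabulate _ i) (dec-true (P? i) Pi))

  ∈-subsetOf⁻ : ∀ {i} → i ∈ₛ subsetOf → P i
  ∈-subsetOf⁻ {i} i∈ with P? i | trans (sym (lookup∘tabulate _ i)) ([]=⇒lookup i∈)
  ... | yes Pi | _ = Pi
  ... | no _ | ()

∣subsetOf∘lookup∣ : {P : Pred A ℓ} (P? : Decidable P) (xs : List A) →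
                    ∣ subsetOf (P? ∘ lookup xs) ∣ ≡ count P? xs
∣subsetOf∘lookup∣ P? [] = refl
∣subsetOf∘lookup∣ P? (x ∷ xs) with does (P? x)
... | true = cong suc (∣subsetOf∘lookup∣ P? xs)
... | false = ∣subsetOf∘lookup∣ P? xs

geomSum : ℕ → ℕ → ℕ
geomSum b zero = 0
geomSum b (suc n) = b ^ n + geomSum b n

geomSum-suc : ∀ b n → geomSum b (suc n) ≡ 1 + b * geomSum b n
geomSum-suc b zero = cong suc (sym (*-zeroʳ b))
geomSum-suc b (suc n) = begin
  b * b ^ n + geomSum b (suc n)      ≡⟨ cong (b * b ^ n +_) (geomSum-suc b n) ⟩
  b * b ^ n + (1 + b * geomSum b n)  ≡⟨ shuffle b (b ^ n) (geomSum b n) ⟩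
  1 + b * (b ^ n + geomSum b n)      ∎
  where
    open ≡-Reasoning
    shuffle : ∀ b x s → b * x + (1 + b * s) ≡ 1 + b * (x + s)
    shuffle = solve-∀

pred-*-geomSum : ∀ b n .{{_ : NonZero b}} → pred b * geomSum b n + 1 ≡ b ^ n
pred-*-geomSum b zero = cong (_+ 1) (*-zeroʳ (pred b))
pred-*-geomSum b (suc n) = begin
  pred b * (b ^ n + geomSum b n) + 1      ≡⟨ shuffle (pred b) (b ^ n) (geomSum b n) ⟩
  pred b * b ^ n + (pred b * geomSum b n + 1) ≡⟨ cong (pred b * b ^ n +_) (pred-*-geomSum b n) ⟩
  pred b * b ^ n + b ^ n                  ≡⟨ +-comm (pred b * b ^ n) (b ^ n) ⟩
  suc (pred b) * b ^ n                    ≡⟨ cong (_* b ^ n) (suc-pred b) ⟩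
  b * b ^ n                               ∎
  where
    open ≡-Reasoning
    shuffle : ∀ q x s → q * (x + s) + 1 ≡ q * x + (q * s + 1)
    shuffle = solve-∀

geomSum-*-< : ∀ b n {d} .{{_ : NonZero b}} → d < b → geomSum b (suc n) * d < suc d * b ^ n
geomSum-*-< b n {d} d<b = begin-strict
  (b ^ n + geomSum b n) * d        ≡⟨ *-distribʳ-+ d (b ^ n) (geomSum b n) ⟩
  b ^ n * d + geomSum b n * d      <⟨ +-monoʳ-< (b ^ n * d) S*d<bⁿ ⟩
  b ^ n * d + b ^ n                ≡⟨ trans (+-comm (b ^ n * d) (b ^ n)) (cong (b ^ n +_) (*-comm (b ^ n) d)) ⟩
  suc d * b ^ n                    ∎
  where
    open ≤-Reasoning
    S*d<bⁿ : geomSum b n * d < b ^ n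
    S*d<bⁿ = begin-strict
      geomSum b n * d        ≤⟨ *-monoʳ-≤ (geomSum b n) (<⇒≤pred d<b) ⟩
      geomSum b n * pred b   ≡⟨ *-comm (geomSum b n) (pred b) ⟩
      pred b * geomSum b n   <⟨ m<m+n _ z<s ⟩
      pred b * geomSum b n + 1 ≡⟨ pred-*-geomSum b n ⟩
      b ^ n                  ∎

n≤geomSum : ∀ b n .{{_ : NonZero b}} → n ≤ geomSum b n
n≤geomSum b zero = z≤n
n≤geomSum b (suc n) = +-mono-≤ (m^n>0 b n) (n≤geomSum b n)

b≤geomSum : ∀ b n .{{_ : NonZero b}} → b ≤ geomSum b (suc (suc n))
b≤geomSum b n = ≤-trans (m≤m*n b (b ^ n) {{m^n≢0 b n}}) (m≤m+n (b * b ^ n) (geomSum b (suc n)))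

infixl 7 _*ᵥ_ _·_
infixl 6 _+ᵥ_

_*ᵥ_ : ℕ → Vec ℕ n → Vec ℕ n
k *ᵥ v = Vec.map (k *_) v

_+ᵥ_ : Vec ℕ n → Vec ℕ n → Vec ℕ n
_+ᵥ_ = Vec.zipWith _+_

_·_ : Vec ℕ n → Vec ℕ n → ℕ
[] · [] = 0
(u ∷ us) · (v ∷ vs) = u * v + us · vs

·-comm : (u v : Vec ℕ n) → u · v ≡ v · u
·-comm [] [] = refl
·-comm (u ∷ us) (v ∷ vs) = cong₂ _+_ (*-comm u v) (·-comm us vs)

·-*ᵥʳ : ∀ k (u v : Vec ℕ n) → u · (k *ᵥ v) ≡ k * (u · v)
·-*ᵥʳ k [] [] = sym (*-zeroʳ k)
·-*ᵥʳ k (u ∷ us) (v ∷ vs) = trans (cong (u * (k * v) +_) (·-*ᵥʳ k us vs)) (shuffle u k v (us · vs))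
  where
    shuffle : ∀ u k v d → u * (k * v) + k * d ≡ k * (u * v + d)
    shuffle = solve-∀

·-*ᵥˡ : ∀ k (u v : Vec ℕ n) → (k *ᵥ u) · v ≡ k * (u · v)
·-*ᵥˡ k u v = trans (·-comm (k *ᵥ u) v) (trans (·-*ᵥʳ k v u) (cong (k *_) (·-comm v u)))

·-distribʳ-+ᵥ : (u v w : Vec ℕ n) → (u +ᵥ v) · w ≡ u · w + v · w
·-distribʳ-+ᵥ [] [] [] = refl
·-distribʳ-+ᵥ (u ∷ us) (v ∷ vs) (w ∷ ws) =
  trans (cong ((u + v) * w +_) (·-distribʳ-+ᵥ us vs ws)) (shuffle u v w (us · ws) (vs · ws))
  where
    shuffle : ∀ u v w x y → (u + v) * w + (x + y) ≡ (u * w + x) + (v * w + y)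
    shuffle = solve-∀

sublists-All : ∀ {P : Pred A ℓ} {xs} → All P xs → All (All P) (sublists xs)
sublists-All [] = [] ∷ []
sublists-All (px ∷ pxs) = All.++⁺ (All.map⁺ (All.map (px ∷_) (sublists-All pxs))) (sublists-All pxs)

nu-≤ : ∀ {t k} (H : Hypergraph) {G : Pred (Subset (N H)) ℓ} → All G (edges H) →
       (∀ {S} → All G S → Shallow t S → length S ≤ k) → nu t H ≤ k
nu-≤ {t = t} {k = k} H G-edges bound = foldr-preservesᵇ {P = _≤ k} ⊔-lub z≤n
  (All.map⁺ (All.zipWith (λ (G-S , shallow) → bound G-S shallow)
    (All.filter⁺ (shallow? t) (sublists-All G-edges) , All.all-filter (shallow? t) (sublists (edges H)))))

degIn-take-≤ : ∀ {n} k (S : List (Subset n)) v → degIn (take k S) v ≤ degIn S v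
degIn-take-≤ k S v = begin
  degIn (take k S) v                               ≤⟨ m≤m+n _ _ ⟩
  count (v ∈?_) (take k S) + count (v ∈?_) (drop k S) ≡⟨ count-++ (v ∈?_) (take k S) (drop k S) ⟨
  degIn (take k S ++ drop k S) v                   ≡⟨ cong (λ S → degIn S v) (take++drop≡id k S) ⟩
  degIn S v                                        ∎
  where open ≤-Reasoning

shallow-length-≤ : ∀ {n t} {G : Pred (Subset n) ℓ} →
  (∀ {S} → All G S → length S ≡ suc t → ∃ λ v → All (v ∈ₛ_) S) →
  ∀ {S} → All G S → Shallow t S → length S ≤ t
shallow-length-≤ {n = n} {t = t} common-vertex {S} G-S shallow with length S ≤? t
... | yes ≤t = ≤t
... | no ≰t = overfull (common-vertex (All.take⁺ (suc t) G-S) |S₀|≡1+t)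
  where
    S₀ : List (Subset n)
    S₀ = take (suc t) S
    |S₀|≡1+t : length S₀ ≡ suc t
    |S₀|≡1+t = trans (length-take (suc t) S) (m≤n⇒m⊓n≡m (≰⇒> ≰t))
    overfull : (∃ λ v → All (v ∈ₛ_) S₀) → length S ≤ t
    overfull (v , v∈S₀) = contradiction (All.lookup shallow (∈-allFin v)) (<⇒≱ (begin-strict
      t               <⟨ n<1+n t ⟩
      suc t           ≡⟨ |S₀|≡1+t ⟨
      length S₀       ≡⟨ count-all (v ∈?_) v∈S₀ ⟨
      degIn S₀ v      ≤⟨ degIn-take-≤ (suc t) S v ⟩
      degIn S v       ∎))
      where open ≤-Reasoning

toℚᵘ-divℕ : ∀ a b → toℚᵘ (divℕ a (suc b)) ℚᵘ.≃ mkℚᵘ (ℤ.+ a) b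
toℚᵘ-divℕ a b = ℚ.toℚᵘ-fromℚᵘ (mkℚᵘ (ℤ.+ a) b)

divℕ-mono-≤ : ∀ {a b c d} .{{_ : NonZero b}} .{{_ : NonZero d}} → a * d ≤ c * b → divℕ a b ℚ.≤ divℕ c d
divℕ-mono-≤ {a} {suc b} {c} {suc d} ad≤cb = ℚ.toℚᵘ-cancel-≤
  (ℚᵘ.≤-respˡ-≃ (ℚᵘ.≃-sym (toℚᵘ-divℕ a b)) (ℚᵘ.≤-respʳ-≃ (ℚᵘ.≃-sym (toℚᵘ-divℕ c d))
    (*≤* (subst₂ ℤ._≤_ (ℤ.pos-* a (suc d)) (ℤ.pos-* c (suc b)) (+≤+ ad≤cb)))))

divℕ-mono-< : ∀ {a b c d} .{{_ : NonZero b}} .{{_ : NonZero d}} → a * d < c * b → divℕ a b ℚ.< divℕ c d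
divℕ-mono-< {a} {suc b} {c} {suc d} ad<cb = ℚ.toℚᵘ-cancel-<
  (ℚᵘ.<-respˡ-≃ (ℚᵘ.≃-sym (toℚᵘ-divℕ a b)) (ℚᵘ.<-respʳ-≃ (ℚᵘ.≃-sym (toℚᵘ-divℕ c d))
    (*<* (subst₂ ℤ._<_ (ℤ.pos-* a (suc d)) (ℤ.pos-* c (suc b)) (+<+ ad<cb)))))

divℕ-* : ∀ a b c d .{{_ : NonZero b}} .{{_ : NonZero d}} →
         divℕ a b ℚ.* divℕ c d ≡ divℕ (a * c) (b * d)
divℕ-* a (suc b) c (suc d) = ℚ.toℚᵘ-injective
  (ℚᵘ.≃-trans (ℚ.toℚᵘ-homo-* (divℕ a (suc b)) (divℕ c (suc d)))
  (ℚᵘ.≃-trans (ℚᵘ.*-cong (toℚᵘ-divℕ a b) (toℚᵘ-divℕ c d))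
  (ℚᵘ.≃-trans (*≡* (cong (ℤ._* +[1+ d + b * suc d ]) (sym (ℤ.pos-* a c))))
              (ℚᵘ.≃-sym (toℚᵘ-divℕ (a * c) (d + b * suc d))))))

divℕ-nonNeg : ∀ a b → 0ℚ ℚ.≤ divℕ a b
divℕ-nonNeg a zero = ℚ.≤-refl
divℕ-nonNeg a (suc b) = ℚ.nonNegative⁻¹ _ {{ℚ.normalize-nonNeg a (suc b)}}

^ℚ-nonNeg : ∀ {x} k → 0ℚ ℚ.≤ x → 0ℚ ℚ.≤ x ^ℚ k
^ℚ-nonNeg zero _ = ℚ.<⇒≤ (ℚ.positive⁻¹ 1ℚ)
^ℚ-nonNeg {x} (suc k) 0≤x = subst (ℚ._≤ x ℚ.* (x ^ℚ k)) (ℚ.*-zeroʳ x)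
  (ℚ.*-monoˡ-≤-nonNeg x {{nonNegative 0≤x}} (^ℚ-nonNeg k 0≤x))

^ℚ-mono-≤ : ∀ {x y} k → 0ℚ ℚ.≤ x → x ℚ.≤ y → x ^ℚ k ℚ.≤ y ^ℚ k
^ℚ-mono-≤ zero _ _ = ℚ.≤-refl
^ℚ-mono-≤ {x} {y} (suc k) 0≤x x≤y = ℚ.≤-trans
  (ℚ.*-monoˡ-≤-nonNeg x {{nonNegative 0≤x}} (^ℚ-mono-≤ k 0≤x x≤y))
  (ℚ.*-monoʳ-≤-nonNeg (y ^ℚ k) {{nonNegative (^ℚ-nonNeg k (ℚ.≤-trans 0≤x x≤y))}} x≤y)

≤-^ℚ-suc : ∀ {x} k → 1ℚ ℚ.≤ x → x ℚ.≤ x ^ℚ suc k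
≤-^ℚ-suc {x} k 1≤x = subst (ℚ._≤ x ℚ.* (x ^ℚ k)) (ℚ.*-identityʳ x)
  (ℚ.*-monoˡ-≤-nonNeg x {{nonNegative 0≤x}} (subst (ℚ._≤ x ^ℚ k) (1^ℚ k) (^ℚ-mono-≤ k 0≤1 1≤x)))
  where
    0≤1 : 0ℚ ℚ.≤ 1ℚ
    0≤1 = ℚ.<⇒≤ (ℚ.positive⁻¹ 1ℚ)
    0≤x : 0ℚ ℚ.≤ x
    0≤x = ℚ.≤-trans 0≤1 1≤x
    1^ℚ : ∀ k → 1ℚ ^ℚ k ≡ 1ℚ
    1^ℚ zero = refl
    1^ℚ (suc k) = trans (cong (1ℚ ℚ.*_) (1^ℚ k)) (ℚ.*-identityˡ 1ℚ)

divℕ-^ℚ : ∀ a b k .{{_ : NonZero b}} → divℕ a b ^ℚ k ≡ divℕ (a ^ k) (b ^ k)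
divℕ-^ℚ a b zero = refl
divℕ-^ℚ a b (suc k) = trans (cong (divℕ a b ℚ.*_) (divℕ-^ℚ a b k)) (divℕ-* a b (a ^ k) (b ^ k))
  where
    instance
      bᵏ≢0 : NonZero (b ^ k)
      bᵏ≢0 = m^n≢0 b k

[1+↧ε]/↧ε≤1+ε : ∀ ε → 0ℚ ℚ.< ε → divℕ (suc (↧ₙ ε)) (↧ₙ ε) ℚ.≤ 1ℚ ℚ.+ ε
[1+↧ε]/↧ε≤1+ε ε@(mkℚ +[1+ n ] d _) _ = ℚ.toℚᵘ-cancel-≤
  (ℚᵘ.≤-respˡ-≃ (ℚᵘ.≃-sym (toℚᵘ-divℕ (suc (suc d)) d))
    (ℚᵘ.≤-respʳ-≃ (ℚᵘ.≃-sym (ℚ.toℚᵘ-homo-+ 1ℚ ε))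
    (*≤* (+≤+ (subst₂ _≤_ (sym (lhs d)) (sym (rhs d n)) (*-monoˡ-≤ (suc d) (m≤m+n (suc (suc d)) n)))))))
  where
    -- the two cross products in the normal form computed by ℚᵘ
    lhs : ∀ d → suc (d + 0 * suc d + suc d * suc (d + 0 * suc d)) ≡ suc (suc d) * suc d
    lhs = solve-∀
    rhs : ∀ d n → suc (d + (d + 0 * suc d + suc (n * 1)) * suc d) ≡ (suc (suc d) + n) * suc d
    rhs = solve-∀
[1+↧ε]/↧ε≤1+ε (mkℚ (ℤ.+ 0) _ _) (ℚ.*<* 0<0) = contradiction 0<0 (ℤ.<-irrefl refl)
[1+↧ε]/↧ε≤1+ε (mkℚ -[1+ _ ] _ _) (ℚ.*<* ())

geomSum-*-[1/b]^ℚ-< : ∀ b n {d} .{{_ : NonZero b}} .{{_ : NonZero d}} → d < b →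
                      ℕtoℚ (geomSum b (suc n)) ℚ.* (divℕ 1 b ^ℚ n) ℚ.< divℕ (suc d) d
geomSum-*-[1/b]^ℚ-< b n {d} d<b = begin-strict
  divℕ r 1 ℚ.* (divℕ 1 b ^ℚ n)          ≡⟨ cong (divℕ r 1 ℚ.*_) (divℕ-^ℚ 1 b n) ⟩
  divℕ r 1 ℚ.* divℕ (1 ^ n) (b ^ n)     ≡⟨ divℕ-* r 1 (1 ^ n) (b ^ n) ⟩
  divℕ (r * 1 ^ n) (1 * b ^ n)          ≡⟨ cong₂ divℕ r*1ⁿ≡r (*-identityˡ (b ^ n)) ⟩
  divℕ r (b ^ n)                        <⟨ divℕ-mono-< {r} {b ^ n} (geomSum-*-< b n d<b) ⟩
  divℕ (suc d) d                        ∎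
  where
    open ℚ.≤-Reasoning
    r : ℕ
    r = geomSum b (suc n)
    instance
      bⁿ≢0 : NonZero (b ^ n)
      bⁿ≢0 = m^n≢0 b n
    r*1ⁿ≡r : r * 1 ^ n ≡ r
    r*1ⁿ≡r = trans (cong (r *_) (^-zeroˡ n)) (*-identityʳ r)

eta-nonNeg : ∀ t r H → 0ℚ ℚ.≤ eta t r H
eta-nonNeg t r H = divℕ-nonNeg (nu t H * r) (N H * t)

eta-≤ : ∀ {t r p} (H : Hypergraph) .{{_ : NonZero p}} → 1 ≤ t → nu t H ≤ t → r * p < N H →
        eta t r H ℚ.≤ divℕ 1 p
eta-≤ {t} {r} {p} H 1≤t ν≤t rp<N = divℕ-mono-≤ {nu t H * r} {N H * t} (begin
  nu t H * r * p      ≤⟨ *-monoˡ-≤ p (*-monoˡ-≤ r ν≤t) ⟩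
  t * r * p           ≡⟨ *-assoc t r p ⟩
  t * (r * p)         ≤⟨ *-monoʳ-≤ t (<⇒≤ rp<N) ⟩
  t * N H             ≡⟨ *-comm t (N H) ⟩
  N H * t             ≡⟨ *-identityˡ (N H * t) ⟨
  1 * (N H * t)       ∎)
  where
    open ≤-Reasoning
    instance
      Nt≢0 : NonZero (N H * t)
      Nt≢0 = m*n≢0 (N H) t {{>-nonZero (≤-<-trans z≤n rp<N)}} {{>-nonZero 1≤t}}

etaLeRoot-intro : ∀ {t r a} (H : Hypergraph) → 1ℚ ℚ.≤ a → Admissible (suc t) r H →
                  ℕtoℚ r ℚ.* (eta (suc t) r H ^ℚ suc t) ℚ.< a → EtaLeRoot (suc t) r a
etaLeRoot-intro {t} {a = a} H 1≤a admissible bound a′ a<a′ = H , admissible , ℚ.<-≤-trans bound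
  (ℚ.≤-trans (≤-^ℚ-suc t 1≤a) (^ℚ-mono-≤ (suc t) 0≤a (ℚ.<⇒≤ a<a′)))
  where
    0≤a : 0ℚ ℚ.≤ a
    0≤a = ℚ.≤-trans (ℚ.<⇒≤ (ℚ.positive⁻¹ 1ℚ)) 1≤a

-- Vectors over 𝔽ₚ are vectors of naturals read modulo p; AnyV (p ∤_) v says that v is nonzero.
module Projective {p : ℕ} (p-prime : Prime p) where

  instance
    p≢0 : NonZero p
    p≢0 = prime⇒nonZero p-prime

  p∤1 : p ∤ 1
  p∤1 p∣1 = nonTrivial⇒≢1 {{prime⇒nonTrivial p-prime}} (∣1⇒≡1 p∣1)

  infix 4 _≋_
  _≋_ : ℕ → ℕ → Set
  x ≋ y = x % p ≡ y % p

  +-cong-≋ : ∀ {w x y z} → w ≋ x → y ≋ z → w + y ≋ x + z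
  +-cong-≋ {w} {x} {y} {z} w≋x y≋z = begin
    (w + y) % p              ≡⟨ %-distribˡ-+ w y p ⟩
    (w % p + y % p) % p      ≡⟨ cong₂ (λ a b → (a + b) % p) w≋x y≋z ⟩
    (x % p + z % p) % p      ≡⟨ %-distribˡ-+ x z p ⟨
    (x + z) % p              ∎
    where open ≡-Reasoning

  *-cong-≋ : ∀ {w x y z} → w ≋ x → y ≋ z → w * y ≋ x * z
  *-cong-≋ {w} {x} {y} {z} w≋x y≋z = begin
    (w * y) % p              ≡⟨ %-distribˡ-* w y p ⟩
    (w % p * (y % p)) % p    ≡⟨ cong₂ (λ a b → (a * b) % p) w≋x y≋z ⟩
    (x % p * (z % p)) % p    ≡⟨ %-distribˡ-* x z p ⟨
    (x * z) % p              ∎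
    where open ≡-Reasoning

  %-≋ : ∀ x → x % p ≋ x
  %-≋ x = m%n%n≡m%n x p

  ∣⇒≋0 : ∀ {x} → p ∣ x → x ≋ 0
  ∣⇒≋0 {x} p∣x = trans (n∣m⇒m%n≡0 x p p∣x) (sym (m*n%n≡0 0 p))

  ≋0⇒∣ : ∀ {x} → x ≋ 0 → p ∣ x
  ≋0⇒∣ {x} x≋0 = m%n≡0⇒n∣m x p (trans x≋0 (m*n%n≡0 0 p))

  -- Negation modulo p, avoiding truncated subtraction.
  infix 8 -_
  -_ : ℕ → ℕ
  - x = pred p * x

  -x+x≡p*x : ∀ x → - x + x ≡ p * x
  -x+x≡p*x x = trans (+-comm (pred p * x) x) (cong (_* x) (suc-pred p))

  p∤⇒coprime : ∀ {a} → p ∤ a → Coprime a p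
  p∤⇒coprime p∤a (d∣a , d∣p) with prime⇒irreducible p-prime d∣p
  ... | inj₁ d≡1 = d≡1
  ... | inj₂ refl = contradiction d∣a p∤a

  inverse : ∀ {a} → p ∤ a → ∃ λ u → u * a ≋ 1
  inverse {a} p∤a with coprime-Bézout (p∤⇒coprime p∤a)
  ... | Bézout.+- x y 1+yp≡xa = x , (begin
    (x * a) % p        ≡⟨ cong (_% p) 1+yp≡xa ⟨
    (1 + y * p) % p    ≡⟨ %-remove-+ʳ 1 {d = p} (n∣m*n y) ⟩
    1 % p              ∎)
    where open ≡-Reasoning
  ... | Bézout.-+ x y 1+xa≡yp = - x , (begin
    (- x * a) % p                    ≡⟨ %-remove-+ʳ (- x * a) {d = p} (n∣m*n y) ⟨
    (- x * a + y * p) % p            ≡⟨ cong (λ z → (- x * a + z) % p) 1+xa≡yp ⟨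
    (- x * a + (1 + x * a)) % p      ≡⟨ cong (_% p) (shuffle (- x) x a) ⟩
    (1 + (- x + x) * a) % p          ≡⟨ cong (λ z → (1 + z * a) % p) (-x+x≡p*x x) ⟩
    (1 + p * x * a) % p              ≡⟨ %-remove-+ʳ 1 {d = p} (∣m⇒∣m*n a (m∣m*n x)) ⟩
    1 % p                            ∎)
    where
      open ≡-Reasoning
      shuffle : ∀ u x a → u * a + (1 + x * a) ≡ 1 + (u + x) * a
      shuffle = solve-∀

  linear-root : ∀ {a} → p ∤ a → ∀ c → ∃ λ y → y < p × p ∣ a * y + c
  linear-root {a} p∤a c with inverse p∤a
  ... | u , ua≋1 = y , m%n<n (u * - c) p , ≋0⇒∣ (begin
    (a * y + c) % p             ≡⟨ +-cong-≋ {a * y} {a * (u * - c)} (*-cong-≋ {a} refl (%-≋ (u * - c))) refl ⟩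
    (a * (u * - c) + c) % p     ≡⟨ cong (λ z → (z + c) % p) (shuffle a u (- c)) ⟩
    (u * a * - c + c) % p       ≡⟨ +-cong-≋ {u * a * - c} {1 * - c} (*-cong-≋ ua≋1 refl) refl ⟩
    (1 * - c + c) % p           ≡⟨ cong (λ z → (z + c) % p) (*-identityˡ (- c)) ⟩
    (- c + c) % p               ≡⟨ cong (_% p) (-x+x≡p*x c) ⟩
    (p * c) % p                 ≡⟨ ∣⇒≋0 (m∣m*n c) ⟩
    0 % p                       ∎)
    where
      open ≡-Reasoning
      y : ℕ
      y = (u * - c) % p
      shuffle : ∀ a u v → a * (u * v) ≡ u * a * v
      shuffle = solve-∀

  no-two-roots : ∀ {a c y₁ y₂} → p ∤ a → y₁ < y₂ → y₂ < p → p ∣ a * y₁ + c → ¬ (p ∣ a * y₂ + c)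
  no-two-roots {a} {c} {y₁} p∤a y₁<y₂ y₂<p root₁ root₂ with m≤n⇒∃[o]m+o≡n y₁<y₂
  ... | k , refl = <⇒≱ (≤-<-trans (s≤s (m≤n+m k y₁)) y₂<p) (∣⇒≤ p∣1+k)
    where
      shuffle : ∀ a y k c → a * (suc y + k) + c ≡ (a * y + c) + a * suc k
      shuffle = solve-∀
      p∣1+k : p ∣ suc k
      p∣1+k = coprime-divisor (Coprimality.sym (p∤⇒coprime p∤a))
                (∣m+n∣m⇒∣n (subst (p ∣_) (shuffle a y₁ k c) root₂) root₁)

  linear-root-unique : ∀ {a c y₁ y₂} → p ∤ a → y₁ < p → y₂ < p →
                       p ∣ a * y₁ + c → p ∣ a * y₂ + c → y₁ ≡ y₂
  linear-root-unique p∤a y₁<p y₂<p root₁ root₂ with <-cmp _ _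
  ... | tri< y₁<y₂ _ _ = contradiction root₂ (no-two-roots p∤a y₁<y₂ y₂<p root₁)
  ... | tri≈ _ y₁≡y₂ _ = y₁≡y₂
  ... | tri> _ _ y₂<y₁ = contradiction root₁ (no-two-roots p∤a y₂<y₁ y₁<p root₂)

  all∣⊎any∤ : ∀ {n} (v : Vec ℕ n) → AllV (p ∣_) v ⊎ AnyV (p ∤_) v
  all∣⊎any∤ [] = inj₁ []ᵥ
  all∣⊎any∤ (x ∷ v) with p ∣? x | all∣⊎any∤ v
  ... | no p∤x | _ = inj₂ (here p∤x)
  ... | yes _ | inj₂ v≢0 = inj₂ (there v≢0)
  ... | yes p∣x | inj₁ v≡0 = inj₁ (p∣x ∷ᵥ v≡0)

  all∣⇒∣· : ∀ {n} {u : Vec ℕ n} → AllV (p ∣_) u → ∀ v → p ∣ u · v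
  all∣⇒∣· []ᵥ [] = p ∣0
  all∣⇒∣· (p∣u ∷ᵥ u≡0) (v ∷ vs) = ∣m∣n⇒∣m+n (∣m⇒∣m*n v p∣u) (all∣⇒∣· u≡0 vs)

  any∤-*ᵥ : ∀ {n k} {v : Vec ℕ n} → p ∤ k → AnyV (p ∤_) v → AnyV (p ∤_) (k *ᵥ v)
  any∤-*ᵥ {k = k} p∤k =
    VAny.map⁺ ∘ VAny.map λ {x} p∤x p∣kx → [ p∤k , p∤x ]′ (euclidsLemma k x p-prime p∣kx)

  all∣⇒¬any∤ : ∀ {n} {v : Vec ℕ n} → AllV (p ∣_) v → ¬ AnyV (p ∤_) v
  all∣⇒¬any∤ (p∣x ∷ᵥ _) (here p∤x) = p∤x p∣x
  all∣⇒¬any∤ (_ ∷ᵥ v≡0) (there v≢0) = all∣⇒¬any∤ v≡0 v≢0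

  head-nonzero : ∀ {n x} {v : Vec ℕ n} → AnyV (p ∤_) (x ∷ v) → AllV (p ∣_) v → p ∤ x
  head-nonzero (here p∤x) _ = p∤x
  head-nonzero (there v≢0) v≡0 = contradiction v≢0 (all∣⇒¬any∤ v≡0)

  eliminate : ∀ {n} → ℕ → Vec ℕ n → Vec ℕ (suc n) → Vec ℕ n
  eliminate a L′ (b ∷ M) = a *ᵥ M +ᵥ - b *ᵥ L′

  backSubstitute : ∀ {n} → ℕ → Vec ℕ n → Vec ℕ n → Vec ℕ (suc n)
  backSubstitute a L′ y = - (L′ · y) ∷ a *ᵥ y

  ·-backSubstitute : ∀ {n} a (L′ : Vec ℕ n) L y → L · backSubstitute a L′ y ≡ eliminate a L′ L · y
  ·-backSubstitute a L′ (b ∷ M) y = begin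
    b * - (L′ · y) + M · (a *ᵥ y)               ≡⟨ cong (b * - (L′ · y) +_) (·-*ᵥʳ a M y) ⟩
    b * (pred p * (L′ · y)) + a * (M · y)       ≡⟨ shuffle b (pred p) (L′ · y) a (M · y) ⟩
    a * (M · y) + pred p * b * (L′ · y)         ≡⟨ cong₂ _+_ (·-*ᵥˡ a M y) (·-*ᵥˡ (- b) L′ y) ⟨
    (a *ᵥ M) · y + (- b *ᵥ L′) · y              ≡⟨ ·-distribʳ-+ᵥ (a *ᵥ M) (- b *ᵥ L′) y ⟨
    (a *ᵥ M +ᵥ - b *ᵥ L′) · y                   ∎
    where
      open ≡-Reasoning
      shuffle : ∀ b q d a m → b * (q * d) + a * m ≡ a * m + q * b * d
      shuffle = solve-∀

  ·-backSubstitute-pivot : ∀ {n} a (L′ y : Vec ℕ n) → (a ∷ L′) · backSubstitute a L′ y ≡ a * (p * (L′ · y))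
  ·-backSubstitute-pivot a L′ y = begin
    a * - (L′ · y) + L′ · (a *ᵥ y)      ≡⟨ cong (a * - (L′ · y) +_) (·-*ᵥʳ a L′ y) ⟩
    a * - (L′ · y) + a * (L′ · y)       ≡⟨ *-distribˡ-+ a (- (L′ · y)) (L′ · y) ⟨
    a * (- (L′ · y) + L′ · y)           ≡⟨ cong (a *_) (-x+x≡p*x (L′ · y)) ⟩
    a * (p * (L′ · y))                  ∎
    where open ≡-Reasoning

  unit : ∀ n → Vec ℕ (suc n)
  unit n = 1 ∷ Vec.replicate n 0

  ·-unit : ∀ {n} (L : Vec ℕ (suc n)) → L · unit n ≡ Vec.head L
  ·-unit (c ∷ L) = trans (cong₂ _+_ (*-identityʳ c) (·-replicate-0 L)) (+-identityʳ c)
    where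
      ·-replicate-0 : ∀ {n} (L : Vec ℕ n) → L · Vec.replicate n 0 ≡ 0
      ·-replicate-0 [] = refl
      ·-replicate-0 (c ∷ L) = cong₂ _+_ (*-zeroʳ c) (·-replicate-0 L)

  extend-solution : ∀ {n a} {L′ : Vec ℕ n} ys zs → p ∤ a →
    (∃ λ y → AnyV (p ∤_) y × All (λ L → p ∣ L · y) (map (eliminate a L′) (ys ++ zs))) →
    ∃ λ x → AnyV (p ∤_) x × All (λ L → p ∣ L · x) (ys ++ (a ∷ L′) ∷ zs)
  extend-solution {n} {a} {L′} ys zs p∤a (y , y≢0 , y-solves) =
    x , there (any∤-*ᵥ p∤a y≢0) , All.++⁺ (lift (All.++⁻ˡ ys solved)) (pivot ∷ lift (All.++⁻ʳ ys solved))
    where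
      x : Vec ℕ (suc n)
      x = backSubstitute a L′ y
      solved : All (λ L → p ∣ eliminate a L′ L · y) (ys ++ zs)
      solved = All.map⁻ y-solves
      lift : ∀ {Ls} → All (λ L → p ∣ eliminate a L′ L · y) Ls → All (λ L → p ∣ L · x) Ls
      lift = All.map λ {L} → subst (p ∣_) (sym (·-backSubstitute a L′ L y))
      pivot : p ∣ (a ∷ L′) · x
      pivot = subst (p ∣_) (sym (·-backSubstitute-pivot a L′ y)) (∣n⇒∣m*n a (m∣m*n (L′ · y)))

  homogeneous-solution : ∀ {n} (Ls : List (Vec ℕ n)) → length Ls < n →
                         ∃ λ x → AnyV (p ∤_) x × All (λ L → p ∣ L · x) Ls
  homogeneous-solution {suc n} Ls len< with all? (λ L → p ∣? Vec.head L) Ls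
  ... | yes heads∣ = unit n , here p∤1 , All.map (λ {L} → subst (p ∣_) (sym (·-unit L))) heads∣
  ... | no ¬heads∣ with find (All.¬All⇒Any¬ (λ L → p ∣? Vec.head L) Ls ¬heads∣)
  ...   | a ∷ L′ , pivot∈Ls , p∤a with ∈-∃++ pivot∈Ls
  ...     | ys , zs , refl =
    extend-solution ys zs p∤a (homogeneous-solution (map (eliminate a L′) (ys ++ zs)) fewer-equations)
    where
      fewer-equations : length (map (eliminate a L′) (ys ++ zs)) < n
      fewer-equations = subst (_< n) (sym (length-map (eliminate a L′) (ys ++ zs)))
                          (s<s⁻¹ (subst (_< suc n) (length-++-sucʳ ys (a ∷ L′) zs) len<))

  vectors : ∀ n → List (Vec ℕ n)
  vectors zero = [ [] ]
  vectors (suc n) = cartesianProductWith _∷_ (upTo p) (vectors n)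

  -- One vector per line through the origin: the first coordinate not divisible by p is 1.
  points : ∀ n → List (Vec ℕ n)
  points zero = []
  points (suc n) = map (1 ∷_) (vectors n) ++ map (0 ∷_) (points n)

  length-vectors : ∀ n → length (vectors n) ≡ p ^ n
  length-vectors zero = refl
  length-vectors (suc n) = trans (length-cartesianProductWith _∷_ (upTo p) (vectors n))
                                 (cong₂ _*_ (length-upTo p) (length-vectors n))

  length-points : ∀ n → length (points n) ≡ geomSum p n
  length-points zero = refl
  length-points (suc n) = trans (length-++ (map (1 ∷_) (vectors n)))
    (cong₂ _+_ (trans (length-map (1 ∷_) (vectors n)) (length-vectors n))
               (trans (length-map (0 ∷_) (points n)) (length-points n)))

  points-nonzero : ∀ n → All (AnyV (p ∤_)) (points n)
  points-nonzero zero = []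
  points-nonzero (suc n) = All.++⁺ (All.map⁺ (All.universal (λ _ → here p∤1) (vectors n)))
                                   (All.map⁺ (All.map there (points-nonzero n)))

  %-∈-vectors : ∀ {n} (v : Vec ℕ n) → Vec.map (_% p) v ∈ vectors n
  %-∈-vectors [] = ListAny.here refl
  %-∈-vectors (x ∷ v) = ∈-cartesianProductWith⁺ _∷_ (∈-upTo⁺ (m%n<n x p)) (%-∈-vectors v)

  ·-%-≋ : ∀ {n} (L v : Vec ℕ n) → L · Vec.map (_% p) v ≋ L · v
  ·-%-≋ [] [] = refl
  ·-%-≋ (l ∷ L) (x ∷ v) = +-cong-≋ {l * (x % p)} {l * x} (*-cong-≋ {l} refl (%-≋ x)) (·-%-≋ L v)

  representative : ∀ {n} {x : Vec ℕ n} → AnyV (p ∤_) x →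
                   ∃ λ x′ → x′ ∈ points n × (∀ L → p ∣ L · x → p ∣ L · x′)
  representative {suc n} {x₀ ∷ x} x≢0 with p ∣? x₀
  ... | yes p∣x₀ with x≢0
  ...   | here p∤x₀ = contradiction p∣x₀ p∤x₀
  ...   | there x≢0′ with representative x≢0′
  ...     | x′ , x′∈ , preserves =
    0 ∷ x′ , ∈-++⁺ʳ (map (1 ∷_) (vectors n)) (∈-map⁺ (0 ∷_) x′∈) , preserves′
    where
      preserves′ : ∀ L → p ∣ L · (x₀ ∷ x) → p ∣ L · (0 ∷ x′)
      preserves′ (l ∷ L) p∣ = subst (p ∣_) (cong (_+ L · x′) (sym (*-zeroʳ l)))
                                (preserves L (∣m+n∣m⇒∣n p∣ (∣n⇒∣m*n l p∣x₀)))
  representative {suc n} {x₀ ∷ x} x≢0 | no p∤x₀ with inverse p∤x₀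
  ... | u , ux₀≋1 = 1 ∷ ux , ∈-++⁺ˡ (∈-map⁺ (1 ∷_) (%-∈-vectors (u *ᵥ x))) , preserves
    where
      ux : Vec ℕ n
      ux = Vec.map (_% p) (u *ᵥ x)
      preserves : ∀ L → p ∣ L · (x₀ ∷ x) → p ∣ L · (1 ∷ ux)
      preserves (l ∷ L) p∣ = ≋0⇒∣ (begin
        (l * 1 + L · ux) % p                     ≡⟨ +-cong-≋ {l * 1} {l * (u * x₀)}
                                                      (*-cong-≋ {l} refl (sym ux₀≋1)) (·-%-≋ L (u *ᵥ x)) ⟩
        (l * (u * x₀) + L · (u *ᵥ x)) % p        ≡⟨ cong (λ z → (l * (u * x₀) + z) % p) (·-*ᵥʳ u L x) ⟩
        (l * (u * x₀) + u * (L · x)) % p         ≡⟨ cong (_% p) (shuffle l u x₀ (L · x)) ⟩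
        (u * (l * x₀ + L · x)) % p               ≡⟨ ∣⇒≋0 (∣n⇒∣m*n u p∣) ⟩
        0 % p                                    ∎)
        where
          open ≡-Reasoning
          shuffle : ∀ l u x d → l * (u * x) + u * d ≡ u * (l * x + d)
          shuffle = solve-∀

  count-∣-cong : ∀ {f g : A → ℕ} → (∀ x → f x ≡ g x) →
                 ∀ xs → count (λ x → p ∣? f x) xs ≡ count (λ x → p ∣? g x) xs
  count-∣-cong f≡g = count-≐ _ _ ((λ {x} → subst (p ∣_) (f≡g x)) , (λ {x} → subst (p ∣_) (sym (f≡g x))))

  count-slice : ∀ {n} a₀ (a : Vec ℕ n) c c₀ →
                count (λ y → p ∣? (a₀ ∷ a) · y + c) (map (c₀ ∷_) (vectors n)) ≡
                count (λ y → p ∣? a · y + (a₀ * c₀ + c)) (vectors n)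
  count-slice {n} a₀ a c c₀ = trans (count-map (λ y → p ∣? (a₀ ∷ a) · y + c) (c₀ ∷_) (vectors n))
                                    (count-∣-cong (λ y → shuffle (a₀ * c₀) (a · y) c) (vectors n))
    where
      shuffle : ∀ x d c → x + d + c ≡ d + (x + c)
      shuffle = solve-∀

  -- If the tail of a is nonzero, each value of the first coordinate contributes p ^ (n − 1)
  -- solutions; otherwise only the root of a₀ y + c ≡ 0 contributes, with all p ^ n.
  count-affine : ∀ n (a : Vec ℕ (suc n)) → AnyV (p ∤_) a → ∀ c →
                 count (λ y → p ∣? a · y + c) (vectors (suc n)) ≡ p ^ n
  count-affine n (a₀ ∷ a) a≢0 c with all∣⊎any∤ a
  count-affine zero (a₀ ∷ []) _ c | inj₂ ()
  count-affine (suc n) (a₀ ∷ a) _ c | inj₂ a≢0 =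
    trans (count-cartesianProductWith-const (λ y → p ∣? (a₀ ∷ a) · y + c) _∷_
             (λ c₀ → trans (count-slice a₀ a c c₀) (count-affine n a a≢0 (a₀ * c₀ + c))) (upTo p))
          (cong (_* p ^ n) (length-upTo p))
  count-affine n (a₀ ∷ a) a≢0 c | inj₁ a≡0 with linear-root (head-nonzero a≢0 a≡0) c
  ... | y , y<p , root =
    trans (count-cartesianProductWith (λ y → p ∣? (a₀ ∷ a) · y + c) (λ c₀ → p ∣? a₀ * c₀ + c) _∷_
             on-root off-root (upTo p))
          (trans (cong (_* p ^ n) (count-unique (λ c₀ → p ∣? a₀ * c₀ + c) (upTo⁺ p) (∈-upTo⁺ y<p) root
                    (λ c₀∈ root′ → linear-root-unique (head-nonzero a≢0 a≡0) (∈-upTo⁻ c₀∈) y<p root′ root)))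
                 (*-identityˡ (p ^ n)))
    where
      on-root : ∀ {c₀} → p ∣ a₀ * c₀ + c →
                count (λ y → p ∣? (a₀ ∷ a) · y + c) (map (c₀ ∷_) (vectors n)) ≡ p ^ n
      on-root {c₀} root₀ = trans (count-slice a₀ a c c₀)
        (trans (count-all _ (All.universal (λ y → ∣m∣n⇒∣m+n (all∣⇒∣· a≡0 y) root₀) (vectors n)))
               (length-vectors n))
      off-root : ∀ {c₀} → ¬ p ∣ a₀ * c₀ + c →
                 count (λ y → p ∣? (a₀ ∷ a) · y + c) (map (c₀ ∷_) (vectors n)) ≡ 0
      off-root {c₀} ¬root₀ = trans (count-slice a₀ a c c₀)
        (count-none _ (All.universal (λ y p∣ → ¬root₀ (∣m+n∣m⇒∣n p∣ (all∣⇒∣· a≡0 y))) (vectors n)))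

  count-points-split : ∀ {n} a₀ (a : Vec ℕ n) →
    count (λ x → p ∣? (a₀ ∷ a) · x) (points (suc n)) ≡
    count (λ y → p ∣? a · y + a₀) (vectors n) + count (λ x → p ∣? a · x) (points n)
  count-points-split {n} a₀ a = trans (count-++ (λ x → p ∣? (a₀ ∷ a) · x) (map (1 ∷_) (vectors n)) _)
    (cong₂ _+_ (trans (count-map _ (1 ∷_) (vectors n)) (count-∣-cong finite (vectors n)))
               (trans (count-map _ (0 ∷_) (points n)) (count-∣-cong infinite (points n))))
    where
      finite : ∀ y → a₀ * 1 + a · y ≡ a · y + a₀
      finite y = trans (+-comm (a₀ * 1) (a · y)) (cong (a · y +_) (*-identityʳ a₀))
      infinite : ∀ x → a₀ * 0 + a · x ≡ a · x
      infinite x = cong (_+ a · x) (*-zeroʳ a₀)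

  count-hyperplane : ∀ n (a : Vec ℕ (suc n)) → AnyV (p ∤_) a →
                     count (λ x → p ∣? a · x) (points (suc n)) ≡ geomSum p n
  count-hyperplane n (a₀ ∷ a) a≢0 with all∣⊎any∤ a
  count-hyperplane zero (a₀ ∷ []) _ | inj₂ ()
  count-hyperplane (suc n) (a₀ ∷ a) _ | inj₂ a≢0 = trans (count-points-split a₀ a)
    (cong₂ _+_ (count-affine n a a≢0 a₀) (count-hyperplane n a a≢0))
  count-hyperplane n (a₀ ∷ a) a≢0 | inj₁ a≡0 = trans (count-points-split a₀ a)
    (cong₂ _+_ (count-none _ (All.universal (λ y p∣ → head-nonzero a≢0 a≡0 (∣m+n∣m⇒∣n p∣ (all∣⇒∣· a≡0 y)))
                                            (vectors n)))
               (trans (count-all _ (All.universal (all∣⇒∣· a≡0) (points n))) (length-points n)))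

  hyperplane : ∀ {n} → Vec ℕ n → Subset (length (points n))
  hyperplane {n} e = subsetOf (λ i → p ∣? e · lookup (points n) i)

  ∈-hyperplane⁺ : ∀ {n} {e : Vec ℕ n} {i} → p ∣ e · lookup (points n) i → i ∈ₛ hyperplane e
  ∈-hyperplane⁺ {n} {e} = ∈-subsetOf⁺ (λ i → p ∣? e · lookup (points n) i)

  ∈-hyperplane⁻ : ∀ {n} {e : Vec ℕ n} {i} → i ∈ₛ hyperplane e → p ∣ e · lookup (points n) i
  ∈-hyperplane⁻ {n} {e} = ∈-subsetOf⁻ (λ i → p ∣? e · lookup (points n) i)

  -- PG n: the points and hyperplanes of the (n − 1)-dimensional projective space over 𝔽ₚ,
  -- each hyperplane given by a normal vector.
  PG : ℕ → Hypergraph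
  PG n = record { N = length (points n) ; edges = map hyperplane (points n) }

  PG-uniform : ∀ n → Uniform (geomSum p n) (PG (suc n))
  PG-uniform n = All.map⁺ (All.map (λ {e} e≢0 → trans (∣subsetOf∘lookup∣ (λ x → p ∣? e · x) (points (suc n)))
                                                     (count-hyperplane n e e≢0))
                                   (points-nonzero (suc n)))

  PG-deg : ∀ n i → deg (PG (suc n)) i ≡ geomSum p n
  PG-deg n i = begin
    count (i ∈?_) (map hyperplane pts)       ≡⟨ count-map (i ∈?_) hyperplane pts ⟩
    count (λ e → i ∈? hyperplane e) pts      ≡⟨ count-≐ (λ e → i ∈? hyperplane e) (λ e → p ∣? v · e)
                                                          (on-hyperplane , off-hyperplane) pts ⟩
    count (λ e → p ∣? v · e) pts             ≡⟨ count-hyperplane n v (All.lookup (points-nonzero (suc n)) (∈-lookup i)) ⟩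
    geomSum p n                              ∎
    where
      open ≡-Reasoning
      pts : List (Vec ℕ (suc n))
      pts = points (suc n)
      v : Vec ℕ (suc n)
      v = lookup pts i
      on-hyperplane : ∀ {e} → i ∈ₛ hyperplane e → p ∣ v · e
      on-hyperplane {e} i∈e = subst (p ∣_) (·-comm e v) (∈-hyperplane⁻ {e = e} i∈e)
      off-hyperplane : ∀ {e} → p ∣ v · e → i ∈ₛ hyperplane e
      off-hyperplane {e} p∣ = ∈-hyperplane⁺ {e = e} (subst (p ∣_) (·-comm v e) p∣)

  PG-common-vertex : ∀ {n} (es : List (Vec ℕ n)) → length es < n →
                     ∃ λ i → All (λ e → i ∈ₛ hyperplane e) es
  PG-common-vertex es len< with homogeneous-solution es len<
  ... | x , x≢0 , x-solves with representative x≢0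
  ...   | x′ , x′∈ , preserves = ListAny.index x′∈ , All.map (λ {e} p∣ →
            ∈-hyperplane⁺ {e = e} (subst (λ z → p ∣ e · z) (lookup-index x′∈) (preserves e p∣))) x-solves

  PG-nu-≤ : ∀ {n t} → suc t < n → nu t (PG n) ≤ t
  PG-nu-≤ {n} {t} 1+t<n = nu-≤ (PG n) (All.map⁺ (All.universal (λ e → e , refl) (points n)))
                                (shallow-length-≤ common-vertex)
    where
      common-vertex : ∀ {S} → All (λ s → ∃ λ e → s ≡ hyperplane e) S → length S ≡ suc t →
                      ∃ λ i → All (i ∈ₛ_) S
      common-vertex images |S|≡1+t with All-image⇒map {f = hyperplane {n}} images
      ... | es , refl with PG-common-vertex es (subst (_< n) (trans (sym |S|≡1+t) (length-map hyperplane es)) 1+t<n)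
      ...   | i , i∈es = i , All.map⁺ i∈es

  PG-admissible : ∀ t → 1 ≤ t → Admissible t (geomSum p (suc t)) (PG (suc (suc t)))
  PG-admissible t 1≤t = PG-uniform (suc t) , (geomSum p (suc t) , ≤-trans 1≤t t≤r , PG-deg (suc t)) ,
                        fromℕ< 0<N , subst (t ≤_) (sym (PG-deg (suc t) _)) t≤r
    where
      t≤r : t ≤ geomSum p (suc t)
      t≤r = ≤-trans (n≤1+n t) (n≤geomSum p (suc t))
      0<N : 0 < length (points (suc (suc t)))
      0<N = subst (0 <_) (sym (length-points (suc (suc t)))) (<-≤-trans z<s (n≤geomSum p (suc (suc t))))

  PG-eta-≤ : ∀ t → 1 ≤ t → eta t (geomSum p (suc t)) (PG (suc (suc t))) ℚ.≤ divℕ 1 p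
  PG-eta-≤ t 1≤t = eta-≤ (PG (suc (suc t))) 1≤t (PG-nu-≤ ≤-refl) (begin-strict
    r * p                              ≡⟨ *-comm r p ⟩
    p * r                              <⟨ n<1+n (p * r) ⟩
    1 + p * r                          ≡⟨ geomSum-suc p (suc t) ⟨
    geomSum p (suc (suc t))            ≡⟨ length-points (suc (suc t)) ⟨
    length (points (suc (suc t)))      ∎)
    where
      open ≤-Reasoning
      r : ℕ
      r = geomSum p (suc t)

  PG-r*eta^t-< : ∀ t {d} .{{_ : NonZero d}} → 1 ≤ t → d < p →
                 ℕtoℚ (geomSum p (suc t)) ℚ.* (eta t (geomSum p (suc t)) (PG (suc (suc t))) ^ℚ t) ℚ.<
                 divℕ (suc d) d
  PG-r*eta^t-< t {d} 1≤t d<p = begin-strict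
    ℕtoℚ r ℚ.* (eta t r H ^ℚ t)     ≤⟨ ℚ.*-monoˡ-≤-nonNeg (ℕtoℚ r) {{ℚ.nonNegative (divℕ-nonNeg r 1)}}
                                         (^ℚ-mono-≤ t (eta-nonNeg t r H) (PG-eta-≤ t 1≤t)) ⟩
    ℕtoℚ r ℚ.* (divℕ 1 p ^ℚ t)      <⟨ geomSum-*-[1/b]^ℚ-< p t d<p ⟩
    divℕ (suc d) d                  ∎
    where
      open ℚ.≤-Reasoning
      r : ℕ
      r = geomSum p (suc t)
      H : Hypergraph
      H = PG (suc (suc t))

-- Euclid: a prime factor of k! + 1 exceeds k.
prime-above : ∀ k → ∃ λ p → Prime p × k < p
prime-above k with factorise (suc (k !))
... | record { factors = [] ; isFactorisation = k!+1≡1 } =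
  contradiction (suc-injective k!+1≡1) (>⇒≢ (1≤n! k))
... | record { factors = p ∷ ps ; isFactorisation = k!+1≡p*ps ; factorsPrime = p-prime ∷ _ }
  with k <? p
...   | yes k<p = p , p-prime , k<p
...   | no k≮p = contradiction (∣1⇒≡1 p∣1) (nonTrivial⇒≢1 {{prime⇒nonTrivial p-prime}})
  where
    p∣p! : ∀ {p} → .{{NonZero p}} → p ∣ p !
    p∣p! {suc p} = m∣m*n (p !)
    p∣1 : p ∣ 1
    p∣1 = ∣m+n∣m⇒∣n (subst (p ∣_) (trans (sym k!+1≡p*ps) (+-comm 1 (k !))) (m∣m*n (product ps)))
                    (∣-trans (p∣p! {{prime⇒nonZero p-prime}}) (m≤n⇒m!∣n! (≮⇒≥ k≮p)))

corollary3p10 : (t : ℕ) → 1 ≤ t → (ε : ℚ) → 0ℚ ℚ.< ε →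
    (m : ℕ) → ∃ λ r → m ≤ r × 1 ≤ r × EtaLeRoot t r (1ℚ ℚ.+ ε)
corollary3p10 t@(suc t′) 1≤t ε ε>0 m with prime-above (m + ↧ₙ ε)
... | p , p-prime , m+d<p = r , m≤r , 1≤r , etaLeRoot-intro (PG (suc (suc t))) 1≤1+ε (PG-admissible t 1≤t)
        (ℚ.<-≤-trans (PG-r*eta^t-< t 1≤t d<p) ([1+↧ε]/↧ε≤1+ε ε ε>0))
  where
    open Projective p-prime
    r : ℕ
    r = geomSum p (suc t)
    p≤r : p ≤ r
    p≤r = b≤geomSum p t′
    m≤r : m ≤ r
    m≤r = ≤-trans (≤-trans (m≤m+n m (↧ₙ ε)) (<⇒≤ m+d<p)) p≤r
    1≤r : 1 ≤ r
    1≤r = ≤-trans (>-nonZero⁻¹ p) p≤r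
    d<p : ↧ₙ ε < p
    d<p = ≤-<-trans (m≤n+m (↧ₙ ε) m) m+d<p
    1≤1+ε : 1ℚ ℚ.≤ 1ℚ ℚ.+ ε
    1≤1+ε = subst (ℚ._≤ 1ℚ ℚ.+ ε) (ℚ.+-identityʳ 1ℚ) (ℚ.+-monoʳ-≤ 1ℚ (ℚ.<⇒≤ ε>0))
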